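{- Let $\mathfrak F_2=(X_2,I_2,Y_2,(S_\sigma)_{\sigma\in\tau})$ and $\mathfrak F_1=(X_1,I_1,Y_1,(R_\sigma)_{\sigma\in\tau})$ be polarities with relations satisfying FAx1, FAx2*, FAx3–FAx7, and let $\pi=(p,q):\mathfrak F_2\to\mathfrak F_1$ satisfy MAx1–MAx6. For a frame $\mathfrak F$ let $\mathsf L^*(\mathfrak F)$ be the normal lattice expansion consisting of the clopen elements of $\mathcal G(X)$ with the operators $\overline\alpha^1_{R_\sigma}$ restricted to clopens. Then $\pi^{ -1}=p^{ -1}$ maps clopen elements of $\mathcal G(X_1)$ to clopen elements of $\mathcal G(X_2)$ and is a homomorphism of normal lattice expansions from $\mathsf L^*(\mathfrak F_1)$ to $\mathsf L^*(\mathfrak F_2)$.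
   Context: A polarity is $(X,I,Y)$, $X,Y$ nonempty, $I\subseteq X\times Y$; $x\perp y$ iff $(x,y)\notin I$; $U^\perp=\{y:x\perp y\ \forall x\in U\}$, ${}^\perp V=\{x:x\perp y\ \forall y\in V\}$. Stable sets $A={}^\perp(A^\perp)$, co-stable $B=({}^\perp B)^\perp$ form complete lattices $\mathcal G(X),\mathcal G(Y)$. Priming: $U'=U^\perp$ ($U\subseteq X$), $V'={}^\perp V$ ($V\subseteq Y$). Sorts $Z_1=X,Z_\partial=Y$; $\overline1=\partial,\overline\partial=1$; $w|u$ means $w\perp u$ or $u\perp w$ as sorting dictates. Preorders $x\le z$ iff $\{x\}^\perp\subseteq\{z\}^\perp$, $y\le v$ iff ${}^\perp\{y\}\subseteq{}^\perp\{v\}$; $\Gamma u=\{w:u\le w\}$. Closed element: $\Gamma u$; clopen: $\Gamma u=\{v\}'$ for some $v$ of the other sort; clopen point: $u$ with $\Gamma u$ clopen. Relation of sort $\sigma=(i_{n+1};i_1\cdots i_n)$: $R\subseteq Z_{i_{n+1}}\times\prod_jZ_{i_j}$, $R\vec u=\{w:wR\vec u\}$, Galois dual $vR'\vec u$ iff $w|v$ for all $w\in R\vec u$. $\alpha_R(\vec W)=\bigcup\{R\vec w:w_j\in W_j\}$, $\overline\alpha_R(\vec F)=(\alpha_R(\vec F))''$. $\overline\alpha^1_R(A_1,\ldots,A_n)$ (for $A_j\in\mathcal G(X)$) is $\overline\alpha_R(B_1,\ldots,B_n)$ if $i_{n+1}=1$ and its prime if $i_{n+1}=\partial$, with $B_j=A_j$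 if $i_j=1$, $B_j=A_j'$ if $i_j=\partial$. Homomorphism of normal lattice expansions: lattice homomorphism commuting with corresponding operators. Frame axioms: FAx1: preorders are partial orders. FAx2*: $R_\sigma\vec u$ is closed, and clopen when all $u_j$ are clopen points. FAx3: $wR_\sigma$ decreasing in each argument. FAx4: all sections $wR'_\sigma\vec u[\_]_k$ are Galois sets. FAx5: clopens closed under finite intersections in $\mathcal G(X)$ and $\mathcal G(Y)$. FAx6: closed elements are exactly the intersections of families of clopens. FAx7: $X$ and $Y$ carry Stone topologies generated by clopens and their complements. For $\pi=(p,q)$, $p:X_2\to X_1$, $q:Y_2\to Y_1$, $\pi(w)$ and $\pi^{ -1}(W)$ mean $p,q$ or $p^{ -1},q^{ -1}$ according to sort. MAx1: $x'I_2y'\Rightarrow p(x')I_1q(y')$. MAx2: $xI_1q(y')\Rightarrow\exists x'\in X_2(x\le p(x')\wedge x'I_2y')$. MAx3: $p(x')I_1y\Rightarrow\exists y'\in Y_2(y\le q(y')\wedge x'I_2y')$. MAx4: for all $\vec u$, $v$ (suitably sorted): $\pi(v)R_\sigma\vec u$ iff $\exists\vec w$ with $u_j\le\pi(w_j)$ for all $j$ and $vS_\sigma\vec w$. MAx5: for every point $u$ of $\mathfrak F_1$, $\pi^{ -1}(\Gamma u)=\Gamma v$ for some point $v$ of $\mathfrak F_2$. MAx6: for every point $u$, if $\Gamma u=\{v\}'$ then $\pi^{ -1}(\Gamma u)=(\pi^{ -1}(\Gamma v))'$. -}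

module Defs where

open import Level using (0ℓ)
open import Data.Nat using (ℕ)
open import Data.Fin using (Fin; _≟_)
open import Data.Product using (Σ; ∃; _×_; _,_)
open import Data.Sum using (_⊎_)
open import Data.Unit using (⊤)
open import Data.List using (List; [])
open import Data.List.Relation.Unary.All using (All)
open import Data.List.Relation.Unary.Any using (Any)
open import Relation.Nullary using (¬_; yes; no)
open import Relation.Binary.PropositionalEquality using (_≡_; refl)
open import Relation.Unary using (Pred; _⊆_; _≐_; _∩_; _∪_; ｛_｝; ∁; ⋂)

Sub : Set → Set₁
Sub A = Pred A 0ℓ

data Sort : Set where
  one ∂ : Sort

flip : Sort → Sort
flip one = ∂
flip ∂ = one

Srt : Set → Set → Sort → Set
Srt X Y one = X
Srt X Y ∂ = Y

-- A similarity type τ: a set of relation symbols σ, each with a sort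
-- σ = (i_{n+1}; i_1 ⋯ i_n).
record Signature : Set₁ where
  field
    Sym : Set
    ar  : Sym → ℕ
    dom : (σ : Sym) → Fin (ar σ) → Sort
    cod : Sym → Sort
open Signature public

record Frame (τ : Signature) : Set₁ where
  field
    X  : Set
    Y  : Set
    x₀ : X
    y₀ : Y
    I  : X → Y → Set

    R : (σ : Sym τ) → Srt X Y (cod τ σ) → ((j : Fin (ar τ σ)) → Srt X Y (dom τ σ j)) → Set

  Z : Sort → Set
  Z = Srt X Y

  perp : (i : Sort) → Z i → Z (flip i) → Set
  perp one x y = ¬ I x y
  perp ∂ y x = ¬ I x y

  prime : (i : Sort) → Sub (Z i) → Sub (Z (flip i))
  prime i U v = ∀ w → U w → perp i w v

  primeTo : (i : Sort) → Sub (Z (flip i)) → Sub (Z i)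
  primeTo one V = prime ∂ V
  primeTo ∂ V = prime one V

  cl : (i : Sort) → Sub (Z i) → Sub (Z i)
  cl i U = primeTo i (prime i U)

  Galois : (i : Sort) → Sub (Z i) → Set
  Galois i U = U ≐ cl i U

  leq : (i : Sort) → Z i → Z i → Set
  leq i u w = ∀ v → perp i u v → perp i w v

  Γ : (i : Sort) → Z i → Sub (Z i)
  Γ i u w = leq i u w

  Closed : (i : Sort) → Sub (Z i) → Set
  Closed i U = Σ (Z i) λ u → U ≐ Γ i u

  Clopen : (i : Sort) → Sub (Z i) → Set
  Clopen i U = Σ (Z i) λ u → (U ≐ Γ i u) × Σ (Z (flip i)) λ v → Γ i u ≐ primeTo i ｛ v ｝

  ClopenPt : (i : Sort) → Z i → Set
  ClopenPt i u = Σ (Z (flip i)) λ v → Γ i u ≐ primeTo i ｛ v ｝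

  Rset : (σ : Sym τ) → ((j : Fin (ar τ σ)) → Z (dom τ σ j)) → Sub (Z (cod τ σ))
  Rset σ us w = R σ w us

  R′ : (σ : Sym τ) → Z (flip (cod τ σ)) → ((j : Fin (ar τ σ)) → Z (dom τ σ j)) → Set
  R′ σ v us = ∀ w → R σ w us → perp (cod τ σ) w v

  α : (σ : Sym τ) → ((j : Fin (ar τ σ)) → Sub (Z (dom τ σ j))) → Sub (Z (cod τ σ))
  α σ Ws w = Σ ((j : Fin (ar τ σ)) → Z (dom τ σ j)) λ ws → (∀ j → Ws j (ws j)) × R σ w ws

  ᾱ : (σ : Sym τ) → ((j : Fin (ar τ σ)) → Sub (Z (dom τ σ j))) → Sub (Z (cod τ σ))
  ᾱ σ Ws = cl (cod τ σ) (α σ Ws)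

  toSort : (i : Sort) → Sub X → Sub (Z i)
  toSort one A = A
  toSort ∂ A = prime one A

  fromSort : (i : Sort) → Sub (Z i) → Sub X
  fromSort one U = U
  fromSort ∂ V = prime ∂ V

  ᾱ¹ : (σ : Sym τ) → (Fin (ar τ σ) → Sub X) → Sub X
  ᾱ¹ σ As = fromSort (cod τ σ) (ᾱ σ (λ j → toSort (dom τ σ j) (As j)))

upd : ∀ {n} {A : Fin n → Set} → ((j : Fin n) → A j) → (k : Fin n) → A k → (j : Fin n) → A j
upd f k a j with k ≟ j
... | yes refl = a
... | no _ = f j

⋂F : {A : Set} {n : ℕ} → (Fin n → Sub A) → Sub A
⋂F Us x = ∀ k → Us k x

module _ {A : Set} (S : Pred (Sub A) (Level.suc 0ℓ)) where

  GenOpen : Sub A → Set₁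
  GenOpen U = Σ Set λ K → Σ (K → ℕ) λ n → Σ ((k : K) → Fin (n k) → Sub A) λ B →
                (∀ k j → S (B k j)) × (U ≐ (λ x → Σ K λ k → ⋂F (B k) x))

  Compact : Set₁
  Compact = ∀ (K : Set) (O : K → Sub A) → (∀ k → GenOpen (O k)) →
            (∀ x → Σ K λ k → O k x) →
            Σ (List K) λ ks → ∀ x → Any (λ k → O k x) ks

  Hausdorff : Set₁
  Hausdorff = ∀ x y → ¬ x ≡ y → Σ (Sub A) λ U → Σ (Sub A) λ V →
              GenOpen U × GenOpen V × U x × V y × (∀ z → U z → V z → Data.Empty.⊥)
    where import Data.Empty

  ZeroDim : Set₁
  ZeroDim = ∀ U → GenOpen U → ∀ x → U x → Σ (Sub A) λ C →
            GenOpen C × GenOpen (∁ C) × C x × C ⊆ U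

  Stone : Set₁
  Stone = Compact × Hausdorff × ZeroDim

module _ {τ : Signature} (F : Frame τ) where
  open Frame F

  FAx1 : Set
  FAx1 = ∀ i (u w : Z i) → leq i u w → leq i w u → u ≡ w

  FAx2* : Set
  FAx2* = ∀ (σ : Sym τ) (us : (j : Fin (ar τ σ)) → Z (dom τ σ j)) →
          Closed (cod τ σ) (Rset σ us) ×
          ((∀ j → ClopenPt (dom τ σ j) (us j)) → Clopen (cod τ σ) (Rset σ us))

  FAx3 : Set
  FAx3 = ∀ (σ : Sym τ) (w : Z (cod τ σ)) (us : (j : Fin (ar τ σ)) → Z (dom τ σ j))
           (k : Fin (ar τ σ)) (z : Z (dom τ σ k)) →
         leq (dom τ σ k) z (us k) → R σ w us → R σ w (upd us k z)

  FAx4 : Set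
  FAx4 = ∀ (σ : Sym τ) (w : Z (flip (cod τ σ))) (us : (j : Fin (ar τ σ)) → Z (dom τ σ j))
           (k : Fin (ar τ σ)) →
         Galois (dom τ σ k) (λ z → R′ σ w (upd us k z))

  FAx5 : Set₁
  FAx5 = ∀ i (n : ℕ) (Us : Fin n → Sub (Z i)) → (∀ k → Clopen i (Us k)) → Clopen i (⋂F Us)

  FAx6 : Set₁
  FAx6 = ∀ i (U : Sub (Z i)) →
         (Closed i U → Σ Set λ K → Σ (K → Sub (Z i)) λ C → (∀ k → Clopen i (C k)) × (U ≐ ⋂ K C)) ×
         ((Σ Set λ K → Σ (K → Sub (Z i)) λ C → (∀ k → Clopen i (C k)) × (U ≐ ⋂ K C)) → Closed i U)

  ClopenSubbasis : (i : Sort) → Pred (Sub (Z i)) (Level.suc 0ℓ)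
  ClopenSubbasis i P = Clopen i P ⊎ Σ (Sub (Z i)) λ C → Clopen i C × (P ≐ ∁ C)

  FAx7 : Set₁
  FAx7 = ∀ i → Stone (ClopenSubbasis i)

  FrameAxioms : Set₁
  FrameAxioms = FAx1 × FAx2* × FAx3 × FAx4 × FAx5 × FAx6 × FAx7

record FrameMap {τ : Signature} (F₂ F₁ : Frame τ) : Set where
  private
    module F₁ = Frame F₁
    module F₂ = Frame F₂
  field
    p : F₂.X → F₁.X
    q : F₂.Y → F₁.Y

  π : (i : Sort) → F₂.Z i → F₁.Z i
  π one = p
  π ∂ = q

  π⁻¹ : (i : Sort) → Sub (F₁.Z i) → Sub (F₂.Z i)
  π⁻¹ i U w = U (π i w)

module _ {τ : Signature} {F₂ F₁ : Frame τ} (m : FrameMap F₂ F₁) where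
  private
    module F₁ = Frame F₁
    module F₂ = Frame F₂
  open FrameMap m

  MAx1 : Set
  MAx1 = ∀ x′ y′ → F₂.I x′ y′ → F₁.I (p x′) (q y′)

  MAx2 : Set
  MAx2 = ∀ x y′ → F₁.I x (q y′) → Σ F₂.X λ x′ → F₁.leq one x (p x′) × F₂.I x′ y′

  MAx3 : Set
  MAx3 = ∀ x′ y → F₁.I (p x′) y → Σ F₂.Y λ y′ → F₁.leq ∂ y (q y′) × F₂.I x′ y′

  MAx4 : Set
  MAx4 = ∀ (σ : Sym τ) (us : (j : Fin (ar τ σ)) → F₁.Z (dom τ σ j)) (v : F₂.Z (cod τ σ)) →
         (F₁.R σ (π (cod τ σ) v) us →
            Σ ((j : Fin (ar τ σ)) → F₂.Z (dom τ σ j)) λ ws →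
              (∀ j → F₁.leq (dom τ σ j) (us j) (π (dom τ σ j) (ws j))) × F₂.R σ v ws) ×
         ((Σ ((j : Fin (ar τ σ)) → F₂.Z (dom τ σ j)) λ ws →
              (∀ j → F₁.leq (dom τ σ j) (us j) (π (dom τ σ j) (ws j))) × F₂.R σ v ws) →
            F₁.R σ (π (cod τ σ) v) us)

  MAx5 : Set
  MAx5 = ∀ i (u : F₁.Z i) → Σ (F₂.Z i) λ v → π⁻¹ i (F₁.Γ i u) ≐ F₂.Γ i v

  MAx6 : Set
  MAx6 = ∀ i (u : F₁.Z i) (v : F₁.Z (flip i)) →
         F₁.Γ i u ≐ F₁.primeTo i ｛ v ｝ →
         π⁻¹ i (F₁.Γ i u) ≐ F₂.primeTo i (π⁻¹ (flip i) (F₁.Γ (flip i) v))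

  MapAxioms : Set
  MapAxioms = MAx1 × MAx2 × MAx3 × MAx4 × MAx5 × MAx6

module _ {τ : Signature} {F₂ F₁ : Frame τ} (m : FrameMap F₂ F₁) where
  private
    module F₁ = Frame F₁
    module F₂ = Frame F₂
  open FrameMap m

  PreservesClopens : Set₁
  PreservesClopens = ∀ A → F₁.Clopen one A → F₂.Clopen one (π⁻¹ one A)

  IsNLEHom : Set₁
  IsNLEHom =
    (∀ A B → F₁.Clopen one A → F₁.Clopen one B →
       π⁻¹ one (A ∩ B) ≐ (π⁻¹ one A ∩ π⁻¹ one B)) ×
    (∀ A B → F₁.Clopen one A → F₁.Clopen one B →
       π⁻¹ one (F₁.cl one (A ∪ B)) ≐ F₂.cl one (π⁻¹ one A ∪ π⁻¹ one B)) ×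
    (∀ (σ : Sym τ) (As : Fin (ar τ σ) → Sub F₁.X) → (∀ j → F₁.Clopen one (As j)) →
       π⁻¹ one (F₁.ᾱ¹ σ As) ≐ F₂.ᾱ¹ σ (λ j → π⁻¹ one (As j)))

{-# OPTIONS --safe #-}
-- Every set that π⁻¹ has to transport (clopens, their primes, R-images,
-- unions of clopens) is increasing for the frame preorder.  On increasing
-- sets MAx1–MAx3 make π⁻¹ commute with priming, hence with the closure ″,
-- and MAx4 makes it commute with α; composing these gives the operator
-- equations.  Clopens are preserved because MAx5 and MAx6 carry
-- Γu = {v}′ to Γu₂ = (Γv₂)′, and (Γv₂)′ = {v₂}′.
module Submission where

open import Defs
open import Data.Product using (_×_; _,_; proj₁; proj₂)
open import Data.Sum using (inj₁; inj₂)
open import Data.Fin using (Fin)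
open import Relation.Unary using (_⊆_; _≐_; _∪_; ｛_｝)
open import Relation.Unary.Properties using (≐-refl; ≐-sym; ≐-trans)
open import Relation.Binary.PropositionalEquality using (refl)

module _ {τ : Signature} (F : Frame τ) where
  open Frame F

  Increasing : (i : Sort) → Sub (Z i) → Set
  Increasing i U = ∀ {u w} → leq i u w → U u → U w

  leq-refl : ∀ i {u : Z i} → leq i u u
  leq-refl i v h = h

  Γ-increasing : ∀ i (u : Z i) → Increasing i (Γ i u)
  Γ-increasing i u u≤w w≤z v h = u≤w v (w≤z v h)

  ≐Γ-increasing : ∀ i {U : Sub (Z i)} (u : Z i) → U ≐ Γ i u → Increasing i U
  ≐Γ-increasing i u (U⊆Γ , Γ⊆U) le x = Γ⊆U (Γ-increasing i u le (U⊆Γ x))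

  clopen-increasing : ∀ i {U : Sub (Z i)} → Clopen i U → Increasing i U
  clopen-increasing i (u , U≐Γu , _) = ≐Γ-increasing i u U≐Γu

  ∪-increasing : ∀ i {U V : Sub (Z i)} → Increasing i U → Increasing i V → Increasing i (U ∪ V)
  ∪-increasing i U↑ V↑ le (inj₁ u) = inj₁ (U↑ le u)
  ∪-increasing i U↑ V↑ le (inj₂ v) = inj₂ (V↑ le v)

  prime-increasing : ∀ i (U : Sub (Z i)) → Increasing (flip i) (prime i U)
  prime-increasing one U le h w u = le w (h w u)
  prime-increasing ∂ U le h w u = le w (h w u)

  primeTo-increasing : ∀ i (V : Sub (Z (flip i))) → Increasing i (primeTo i V)
  primeTo-increasing one = prime-increasing ∂
  primeTo-increasing ∂ = prime-increasing one

  cl-increasing : ∀ i (U : Sub (Z i)) → Increasing i (cl i U)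
  cl-increasing i U = primeTo-increasing i (prime i U)

  toSort-increasing : ∀ i {A : Sub X} → Increasing one A → Increasing i (toSort i A)
  toSort-increasing one A↑ = A↑
  toSort-increasing ∂ {A} _ = prime-increasing one A

  α-increasing : FAx2* F → ∀ σ Ws → Increasing (cod τ σ) (α σ Ws)
  α-increasing fax2 σ Ws le (ws , ws∈Ws , r) =
    let (u , Rws≐Γu) = proj₁ (fax2 σ ws)
    in ws , ws∈Ws , ≐Γ-increasing (cod τ σ) u Rws≐Γu le r

  prime-antitone : ∀ i {U U′ : Sub (Z i)} → U ⊆ U′ → prime i U′ ⊆ prime i U
  prime-antitone i U⊆U′ h w u = h w (U⊆U′ u)

  prime-cong : ∀ i {U U′ : Sub (Z i)} → U ≐ U′ → prime i U ≐ prime i U′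
  prime-cong i (U⊆U′ , U′⊆U) = prime-antitone i U′⊆U , prime-antitone i U⊆U′

  primeTo-cong : ∀ i {V V′ : Sub (Z (flip i))} → V ≐ V′ → primeTo i V ≐ primeTo i V′
  primeTo-cong one = prime-cong ∂
  primeTo-cong ∂ = prime-cong one

  cl-cong : ∀ i {U U′ : Sub (Z i)} → U ≐ U′ → cl i U ≐ cl i U′
  cl-cong i U≐U′ = primeTo-cong i (prime-cong i U≐U′)

  fromSort-cong : ∀ i {V V′ : Sub (Z i)} → V ≐ V′ → fromSort i V ≐ fromSort i V′
  fromSort-cong one V≐V′ = V≐V′
  fromSort-cong ∂ = prime-cong ∂

  α-cong : ∀ σ {Ws Ws′ : (j : Fin (ar τ σ)) → Sub (Z (dom τ σ j))} →
           (∀ j → Ws j ≐ Ws′ j) → α σ Ws ≐ α σ Ws′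
  α-cong σ Ws≐Ws′ = (λ (ws , ws∈ , r) → ws , (λ j → proj₁ (Ws≐Ws′ j) (ws∈ j)) , r)
                  , (λ (ws , ws∈ , r) → ws , (λ j → proj₂ (Ws≐Ws′ j) (ws∈ j)) , r)

  ᾱ-cong : ∀ σ {Ws Ws′ : (j : Fin (ar τ σ)) → Sub (Z (dom τ σ j))} →
           (∀ j → Ws j ≐ Ws′ j) → ᾱ σ Ws ≐ ᾱ σ Ws′
  ᾱ-cong σ Ws≐Ws′ = cl-cong (cod τ σ) (α-cong σ Ws≐Ws′)

  prime-Γ : ∀ i (u : Z i) → prime i (Γ i u) ≐ prime i ｛ u ｝
  prime-Γ i u = (λ h → λ { w refl → h w (leq-refl i) })
              , (λ {v} h w u≤w → u≤w v (h u refl))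

  primeTo-Γ : ∀ i (v : Z (flip i)) → primeTo i (Γ (flip i) v) ≐ primeTo i ｛ v ｝
  primeTo-Γ one = prime-Γ ∂
  primeTo-Γ ∂ = prime-Γ one

module _ {τ : Signature} {F₂ F₁ : Frame τ} (m : FrameMap F₂ F₁) where
  private
    module F₁ = Frame F₁
    module F₂ = Frame F₂
  open FrameMap m

  π⁻¹-cong : ∀ i {U U′ : Sub (F₁.Z i)} → U ≐ U′ → π⁻¹ i U ≐ π⁻¹ i U′
  π⁻¹-cong i (U⊆U′ , U′⊆U) = U⊆U′ , U′⊆U

  module _ (ax1 : MAx1 m) (ax2 : MAx2 m) (ax3 : MAx3 m) where

    π⁻¹-prime : ∀ i {U : Sub (F₁.Z i)} → Increasing F₁ i U →
                π⁻¹ (flip i) (F₁.prime i U) ≐ F₂.prime i (π⁻¹ i U)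
    π⁻¹-prime one U↑ =
        (λ {y′} h x′ u x′Iy′ → h (p x′) u (ax1 x′ y′ x′Iy′))
      , (λ {y′} h x u xIqy′ → let (x′ , x≤px′ , x′Iy′) = ax2 x y′ xIqy′ in h x′ (U↑ x≤px′ u) x′Iy′)
    π⁻¹-prime ∂ U↑ =
        (λ {x′} h y′ u x′Iy′ → h (q y′) u (ax1 x′ y′ x′Iy′))
      , (λ {x′} h y u px′Iy → let (y′ , y≤qy′ , x′Iy′) = ax3 x′ y px′Iy in h y′ (U↑ y≤qy′ u) x′Iy′)

    π⁻¹-primeTo : ∀ i {V : Sub (F₁.Z (flip i))} → Increasing F₁ (flip i) V →
                  π⁻¹ i (F₁.primeTo i V) ≐ F₂.primeTo i (π⁻¹ (flip i) V)
    π⁻¹-primeTo one = π⁻¹-prime ∂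
    π⁻¹-primeTo ∂ = π⁻¹-prime one

    π⁻¹-cl : ∀ i {U : Sub (F₁.Z i)} → Increasing F₁ i U →
             π⁻¹ i (F₁.cl i U) ≐ F₂.cl i (π⁻¹ i U)
    π⁻¹-cl i {U} U↑ =
      ≐-trans (π⁻¹-primeTo i (prime-increasing F₁ i U))
              (primeTo-cong F₂ i (π⁻¹-prime i U↑))

    π⁻¹-toSort : ∀ i {A : Sub F₁.X} → Increasing F₁ one A →
                 π⁻¹ i (F₁.toSort i A) ≐ F₂.toSort i (π⁻¹ one A)
    π⁻¹-toSort one _ = ≐-refl
    π⁻¹-toSort ∂ = π⁻¹-prime one

    π⁻¹-fromSort : ∀ i {V : Sub (F₁.Z i)} → Increasing F₁ i V →
                   π⁻¹ one (F₁.fromSort i V) ≐ F₂.fromSort i (π⁻¹ i V)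
    π⁻¹-fromSort one _ = ≐-refl
    π⁻¹-fromSort ∂ = π⁻¹-prime ∂

  π⁻¹-α : MAx4 m → ∀ σ (Ws : (j : Fin (ar τ σ)) → Sub (F₁.Z (dom τ σ j))) →
          (∀ j → Increasing F₁ (dom τ σ j) (Ws j)) →
          π⁻¹ (cod τ σ) (F₁.α σ Ws) ≐ F₂.α σ (λ j → π⁻¹ (dom τ σ j) (Ws j))
  π⁻¹-α ax4 σ Ws Ws↑ = forth , back
    where
    forth : π⁻¹ (cod τ σ) (F₁.α σ Ws) ⊆ F₂.α σ (λ j → π⁻¹ (dom τ σ j) (Ws j))
    forth {v} (us , us∈Ws , r) =
      let (ws , us≤πws , s) = proj₁ (ax4 σ us v) r
      in ws , (λ j → Ws↑ j (us≤πws j) (us∈Ws j)) , s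
    back : F₂.α σ (λ j → π⁻¹ (dom τ σ j) (Ws j)) ⊆ π⁻¹ (cod τ σ) (F₁.α σ Ws)
    back {v} (ws , πws∈Ws , s) =
      let πws = λ j → π (dom τ σ j) (ws j)
      in πws , πws∈Ws , proj₂ (ax4 σ πws v) (ws , (λ j → leq-refl F₁ (dom τ σ j)) , s)

  module _ (fax2 : FAx2* F₁) (ax1 : MAx1 m) (ax2 : MAx2 m) (ax3 : MAx3 m) (ax4 : MAx4 m) where

    π⁻¹-ᾱ : ∀ σ (Ws : (j : Fin (ar τ σ)) → Sub (F₁.Z (dom τ σ j))) →
            (∀ j → Increasing F₁ (dom τ σ j) (Ws j)) →
            π⁻¹ (cod τ σ) (F₁.ᾱ σ Ws) ≐ F₂.ᾱ σ (λ j → π⁻¹ (dom τ σ j) (Ws j))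
    π⁻¹-ᾱ σ Ws Ws↑ =
      ≐-trans (π⁻¹-cl ax1 ax2 ax3 (cod τ σ) (α-increasing F₁ fax2 σ Ws))
              (cl-cong F₂ (cod τ σ) (π⁻¹-α ax4 σ Ws Ws↑))

    π⁻¹-ᾱ¹ : ∀ σ (As : Fin (ar τ σ) → Sub F₁.X) → (∀ j → Increasing F₁ one (As j)) →
             π⁻¹ one (F₁.ᾱ¹ σ As) ≐ F₂.ᾱ¹ σ (λ j → π⁻¹ one (As j))
    π⁻¹-ᾱ¹ σ As As↑ =
      ≐-trans (π⁻¹-fromSort ax1 ax2 ax3 (cod τ σ) (cl-increasing F₁ (cod τ σ) _))
              (fromSort-cong F₂ (cod τ σ)
                (≐-trans (π⁻¹-ᾱ σ Bs (λ j → toSort-increasing F₁ (dom τ σ j) (As↑ j)))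
                         (ᾱ-cong F₂ σ (λ j → π⁻¹-toSort ax1 ax2 ax3 (dom τ σ j) (As↑ j)))))
      where
      Bs : (j : Fin (ar τ σ)) → Sub (F₁.Z (dom τ σ j))
      Bs j = F₁.toSort (dom τ σ j) (As j)

  π⁻¹-preserves-clopens : MAx5 m → MAx6 m → PreservesClopens m
  π⁻¹-preserves-clopens ax5 ax6 A (u , A≐Γu , v , Γu≐v′) =
    let (u₂ , π⁻¹Γu≐Γu₂) = ax5 one u
        (v₂ , π⁻¹Γv≐Γv₂) = ax5 ∂ v
    in u₂ , ≐-trans (π⁻¹-cong one A≐Γu) π⁻¹Γu≐Γu₂
      , v₂ , ≐-trans (≐-sym π⁻¹Γu≐Γu₂)
               (≐-trans (ax6 one u v Γu≐v′)
                 (≐-trans (primeTo-cong F₂ one π⁻¹Γv≐Γv₂) (primeTo-Γ F₂ one v₂)))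

proposition5p2 : {τ : Signature} (F₂ F₁ : Frame τ) (m : FrameMap F₂ F₁) →
    FrameAxioms F₂ → FrameAxioms F₁ → MapAxioms m →
    PreservesClopens m × IsNLEHom m
proposition5p2 F₂ F₁ m _ (_ , fax2 , _) (ax1 , ax2 , ax3 , ax4 , ax5 , ax6) =
    π⁻¹-preserves-clopens m ax5 ax6
  , (λ _ _ _ _ → ≐-refl)
  , (λ A B A-clopen B-clopen → π⁻¹-cl m ax1 ax2 ax3 one
       (∪-increasing F₁ one (clopen-increasing F₁ one A-clopen) (clopen-increasing F₁ one B-clopen)))
  , (λ σ As As-clopen → π⁻¹-ᾱ¹ m fax2 ax1 ax2 ax3 ax4 σ As
       (λ j → clopen-increasing F₁ one (As-clopen j)))
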